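{- If $D$ is a digraph of order $n$, then $dac(D)+dac(D^c)\le \left\lceil \frac{4n}{3}\right\rceil$.
   Context: All digraphs are finite, without loops; symmetric arcs (2-cycles) are permitted. The complement $D^c$ of $D$ is the digraph on $V(D)$ in which, for distinct $u,v$, $uv$ is an arc iff $uv$ is not an arc of $D$. A (vertex) coloring is acyclic if each chromatic class induces a subdigraph with no directed cycle. A coloring is complete if for every ordered pair $(i,j)$ of distinct colors there is an arc $(u,v)$ with $u$ colored $i$ and $v$ colored $j$. The diachromatic number $dac(D)$ is the largest number of colors in an acyclic and complete coloring of $D$. -}

module Defs where

open import Data.Nat using (ℕ; zero; suc; _+_; _*_; _/_)
open import Data.Fin using (Fin)
open import Data.Bool using (Bool; true; false; not)
open import Data.Product using (Σ; ∃; _×_; _,_)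
open import Relation.Binary.PropositionalEquality using (_≡_)
open import Relation.Nullary using (¬_)

-- Loops are excluded: the value of arc u u is ignored everywhere
-- (all notions below only use arcs between distinct vertices).
record Digraph (n : ℕ) : Set where
  field
    arc : Fin n → Fin n → Bool
open Digraph public

Arc : ∀ {n} → Digraph n → Fin n → Fin n → Set
Arc D u v = ¬ (u ≡ v) × arc D u v ≡ true

complement : ∀ {n} → Digraph n → Digraph n
complement D = record { arc = λ u v → not (arc D u v) }

data Walk {n k : ℕ} (D : Digraph n) (c : Fin n → Fin k) (i : Fin k)
          : Fin n → Fin n → Set where
  step : ∀ {u v} → c u ≡ i → c v ≡ i → Arc D u v → Walk D c i u v
  _∷_  : ∀ {u v w} → c u ≡ i → Arc D u v → Walk D c i v w → Walk D c i u w
infixr 5 _∷_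

-- The class of colour i contains a directed cycle (a closed directed walk
-- of positive length inside the class; since there are no loops this is
-- the same as containing a directed cycle).
HasCycleInClass : ∀ {n k} → Digraph n → (Fin n → Fin k) → Fin k → Set
HasCycleInClass D c i = ∃ λ u → Walk D c i u u

Acyclic : ∀ {n k} → Digraph n → (Fin n → Fin k) → Set
Acyclic D c = ∀ i → ¬ HasCycleInClass D c i

Complete : ∀ {n k} → Digraph n → (Fin n → Fin k) → Set
Complete D c = ∀ i j → ¬ (i ≡ j) →
  Σ _ λ u → Σ _ λ v → Arc D u v × c u ≡ i × c v ≡ j

UsesAll : ∀ {n k} → (Fin n → Fin k) → Set
UsesAll c = ∀ i → ∃ λ u → c u ≡ i

ACColouring : ∀ {n} → Digraph n → ℕ → Set
ACColouring {n} D k =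
  Σ (Fin n → Fin k) λ c → UsesAll c × Acyclic D c × Complete D c

ceil4n/3 : ℕ → ℕ
ceil4n/3 n = (4 * n + 2) / 3

{-# OPTIONS --safe #-}
module Submission where

-- If s classes of c₁ are singletons, the other k₁ − s classes have at least
-- two vertices each, so 2k₁ − s ≤ n.  All c₂-colours but at most one meet a
-- non-singleton class of c₁: two colours j ≠ j′ contained in singletons
-- would be joined by an arc uv of Dᶜ, and completeness of c₁ forces uv to be
-- an arc of D as well.  Hence k₂ ≤ (n − s) + 1.  Adding the symmetric bound
-- 2k₂ + k₁ ≤ 2n + 1 gives 3(k₁ + k₂) ≤ 4n + 2.

open import Defs
open import Data.Nat using (ℕ; _+_; _*_; _/_; _≤_)
open import Data.Nat.Properties using (+-mono-≤; ≤-trans; ≤-reflexive; module ≤-Reasoning)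
open import Data.Nat.DivMod using (/-monoˡ-≤; m*n/n≡m)
open import Data.Nat.Solver using (module +-*-Solver)
open import Data.Fin using (Fin; zero; _≟_)
open import Data.Fin.Properties using (any?; injective⇒≤; +↔⊎)
open import Data.Bool using (true; not)
open import Data.Product using (∃; _×_; _,_; proj₁; proj₂)
open import Data.Sum using (_⊎_; inj₁; inj₂; [_,_])
open import Data.Sum.Properties using (inj₁-injective; inj₂-injective)
open import Data.Sum.Function.Propositional using (_⊎-↔_)
open import Data.Empty using (⊥; ⊥-elim)
open import Function using (_∘_)
open import Function.Bundles using (Injection; _↣_; _↔_; mk↣)
open import Function.Definitions using (Injective)
open import Function.Construct.Composition using (_↣-∘_; _↔-∘_)
open import Function.Construct.Identity using (↔-id)
open import Function.Construct.Symmetry using (↔-sym)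
open import Function.Properties.Inverse using (↔⇒↣)
open import Relation.Nullary using (¬_; Dec; yes; no)
open import Relation.Nullary.Decidable using (_×-dec_; ¬?; decidable-stable)
open import Relation.Binary.PropositionalEquality
  using (_≡_; _≢_; refl; sym; trans; cong; subst; subst₂)

[,]-injective : ∀ {a b c} {A : Set a} {B : Set b} {C : Set c}
                {f : A → C} {g : B → C} →
                Injective _≡_ _≡_ f → Injective _≡_ _≡_ g →
                (∀ x y → f x ≢ g y) → Injective _≡_ _≡_ [ f , g ]
[,]-injective f-inj g-inj disj {inj₁ x} {inj₁ x′} eq = cong inj₁ (f-inj eq)
[,]-injective f-inj g-inj disj {inj₁ x} {inj₂ y}  eq = ⊥-elim (disj x y eq)
[,]-injective f-inj g-inj disj {inj₂ y} {inj₁ x}  eq = ⊥-elim (disj x y (sym eq))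
[,]-injective f-inj g-inj disj {inj₂ y} {inj₂ y′} eq = cong inj₂ (g-inj eq)

Fin-+³↔⊎ : ∀ {a b c} → Fin (a + (b + c)) ↔ (Fin a ⊎ (Fin b ⊎ Fin c))
Fin-+³↔⊎ {a} = (↔-id (Fin a) ⊎-↔ +↔⊎) ↔-∘ +↔⊎

⊎³-↣⇒≤ : ∀ {a b c d e f} →
         (Fin a ⊎ (Fin b ⊎ Fin c)) ↣ (Fin d ⊎ (Fin e ⊎ Fin f)) →
         a + (b + c) ≤ d + (e + f)
⊎³-↣⇒≤ inj = injective⇒≤ (Injection.injective
  (↔⇒↣ (↔-sym Fin-+³↔⊎) ↣-∘ (inj ↣-∘ ↔⇒↣ Fin-+³↔⊎)))

complement-disjoint : ∀ {n} {D : Digraph n} {u v} →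
                      Arc D u v → Arc (complement D) u v → ⊥
complement-disjoint (_ , uv∈D) (_ , uv∈Dᶜ) =
  subst (λ b → not b ≡ true → ⊥) (sym uv∈D) (λ ()) uv∈Dᶜ

module _ {n k : ℕ} (c : Fin n → Fin k) where

  SharesColour : Fin n → Set
  SharesColour v = ∃ λ w → c w ≡ c v × w ≢ v

  sharesColour? : ∀ v → Dec (SharesColour v)
  sharesColour? v = any? (λ w → (c w ≟ c v) ×-dec ¬? (w ≟ v))

  lonely-unique : ∀ {v w} → ¬ SharesColour v → c w ≡ c v → w ≡ v
  lonely-unique {v} {w} lonely cw≡cv =
    decidable-stable (w ≟ v) (λ w≢v → lonely (w , cw≡cv , w≢v))

lonely-arc : ∀ {n k} {D : Digraph n} {c : Fin n → Fin k} → Complete D c →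
             ∀ {u v} → ¬ SharesColour c u → ¬ SharesColour c v →
             c u ≢ c v → Arc D u v
lonely-arc {D = D} {c} complete lonely-u lonely-v cu≢cv
  with complete (c _) (c _) cu≢cv
... | u′ , v′ , u′v′ , cu′ , cv′ =
  subst₂ (Arc D) (lonely-unique c lonely-u cu′) (lonely-unique c lonely-v cv′) u′v′

module ArcDisjointColourings {n k₁ k₂ : ℕ} {D E : Digraph n}
  (disjoint : ∀ {u v} → Arc D u v → Arc E u v → ⊥)
  {c₁ : Fin n → Fin k₁} (uses-all₁ : UsesAll c₁) (complete₁ : Complete D c₁)
  {c₂ : Fin n → Fin k₂} (complete₂ : Complete E c₂) where

  MeetsSharedClass : Fin k₂ → Set
  MeetsSharedClass j = ∃ λ v → c₂ v ≡ j × SharesColour c₁ v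

  meetsSharedClass? : ∀ j → Dec (MeetsSharedClass j)
  meetsSharedClass? j = any? (λ v → (c₂ v ≟ j) ×-dec sharesColour? c₁ v)

  avoidsSharedClasses-unique : ∀ {j j′} →
    ¬ MeetsSharedClass j → ¬ MeetsSharedClass j′ → j ≡ j′
  avoidsSharedClasses-unique {j} {j′} avoids avoids′ =
    decidable-stable (j ≟ j′) λ j≢j′ →
      let u , v , uv∈E , cu , cv = complete₂ j j′ j≢j′
          lonely-u = λ shares → avoids (u , cu , shares)
          lonely-v = λ shares → avoids′ (v , cv , shares)
          c₁u≢c₁v = λ eq → lonely-v (u , eq , proj₁ uv∈E)
      in disjoint (lonely-arc complete₁ lonely-u lonely-v c₁u≢c₁v) uv∈E

  rep : Fin k₁ → Fin n
  rep i = proj₁ (uses-all₁ i)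

  c₁-rep : ∀ i → c₁ (rep i) ≡ i
  c₁-rep i = proj₂ (uses-all₁ i)

  rep-injective : Injective _≡_ _≡_ rep
  rep-injective {i} {i′} eq = trans (sym (c₁-rep i)) (trans (cong c₁ eq) (c₁-rep i′))

  -- The first copy of the vertices holds the representatives and one further
  -- vertex of each non-singleton class; the second copy holds the singleton
  -- classes and, for each colour of c₂ meeting a non-singleton class, such a
  -- vertex of that colour; the spare slot takes the at most one remaining
  -- colour of c₂.
  Slot : Set
  Slot = Fin n ⊎ (Fin n ⊎ Fin 1)

  representative : Fin k₁ → Slot
  representative i = inj₁ (rep i)

  partnerFor : ∀ i → Dec (SharesColour c₁ (rep i)) → Slot
  partnerFor i (yes (w , _)) = inj₁ w
  partnerFor i (no _)        = inj₂ (inj₁ (rep i))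

  partner : Fin k₁ → Slot
  partner i = partnerFor i (sharesColour? c₁ (rep i))

  witnessFor : ∀ j → Dec (MeetsSharedClass j) → Slot
  witnessFor j (yes (v , _)) = inj₂ (inj₁ v)
  witnessFor j (no _)        = inj₂ (inj₂ zero)

  witness : Fin k₂ → Slot
  witness j = witnessFor j (meetsSharedClass? j)

  representative-injective : Injective _≡_ _≡_ representative
  representative-injective = rep-injective ∘ inj₁-injective

  partnerFor-injective : ∀ {i i′} d d′ → partnerFor i d ≡ partnerFor i′ d′ → i ≡ i′
  partnerFor-injective {i} {i′} (yes (w , cw , _)) (yes (_ , cw′ , _)) refl =
    trans (sym (c₁-rep i)) (trans (sym cw) (trans cw′ (c₁-rep i′)))
  partnerFor-injective (no _) (no _) eq = rep-injective (inj₁-injective (inj₂-injective eq))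

  partner-injective : Injective _≡_ _≡_ partner
  partner-injective = partnerFor-injective _ _

  witnessFor-injective : ∀ {j j′} e e′ → witnessFor j e ≡ witnessFor j′ e′ → j ≡ j′
  witnessFor-injective (yes (_ , cv , _)) (yes (_ , cv′ , _)) refl = trans (sym cv) cv′
  witnessFor-injective (no avoids) (no avoids′) _ = avoidsSharedClasses-unique avoids avoids′

  witness-injective : Injective _≡_ _≡_ witness
  witness-injective = witnessFor-injective _ _

  partnerFor≢witnessFor : ∀ {i j} d e → partnerFor i d ≢ witnessFor j e
  partnerFor≢witnessFor (yes _)      (yes _)                 ()
  partnerFor≢witnessFor (yes _)      (no _)                  ()
  partnerFor≢witnessFor (no lonely) (yes (_ , _ , shares)) refl = lonely shares
  partnerFor≢witnessFor (no _)       (no _)                  ()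

  representative≢partnerFor : ∀ {i i′} d → representative i ≢ partnerFor i′ d
  representative≢partnerFor {i} {i′} (yes (_ , cw , w≢rep)) refl =
    w≢rep (cong rep (trans (sym (c₁-rep i)) (trans cw (c₁-rep i′))))

  representative≢witnessFor : ∀ {i j} e → representative i ≢ witnessFor j e
  representative≢witnessFor (yes _) ()
  representative≢witnessFor (no _) ()

  encode : (Fin k₁ ⊎ (Fin k₁ ⊎ Fin k₂)) ↣ Slot
  encode = mk↣ ([,]-injective representative-injective
    ([,]-injective partner-injective witness-injective
      (λ _ _ → partnerFor≢witnessFor _ _))
    λ { _ (inj₁ _) → representative≢partnerFor _
      ; _ (inj₂ _) → representative≢witnessFor _ })

  k₁+[k₁+k₂]≤n+[n+1] : k₁ + (k₁ + k₂) ≤ n + (n + 1)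
  k₁+[k₁+k₂]≤n+[n+1] = ⊎³-↣⇒≤ encode

≤ceil4n/3 : ∀ a b n → a + (a + b) ≤ n + (n + 1) → b + (b + a) ≤ n + (n + 1) →
            a + b ≤ ceil4n/3 n
≤ceil4n/3 a b n ab ba = begin
  a + b            ≡⟨ m*n/n≡m (a + b) 3 ⟨
  (a + b) * 3 / 3  ≤⟨ /-monoˡ-≤ 3 thrice ⟩
  ceil4n/3 n       ∎
  where
  open ≤-Reasoning
  open +-*-Solver
  thrice : (a + b) * 3 ≤ 4 * n + 2
  thrice = begin
    (a + b) * 3                          ≡⟨ solve 2 (λ a b → (a :+ b) :* con 3
                                              := (a :+ (a :+ b)) :+ (b :+ (b :+ a))) refl a b ⟩
    (a + (a + b)) + (b + (b + a))        ≤⟨ +-mono-≤ ab ba ⟩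
    (n + (n + 1)) + (n + (n + 1))        ≡⟨ solve 1 (λ m → (m :+ (m :+ con 1)) :+ (m :+ (m :+ con 1))
                                              := con 4 :* m :+ con 2) refl n ⟩
    4 * n + 2                            ∎

mainTheorem5 : ∀ (n : ℕ) (D : Digraph n) (k₁ k₂ : ℕ) →
    ACColouring D k₁ → ACColouring (complement D) k₂ →
    k₁ + k₂ ≤ ceil4n/3 n
mainTheorem5 n D k₁ k₂ (c₁ , uses-all₁ , _ , complete₁) (c₂ , uses-all₂ , _ , complete₂) =
  ≤ceil4n/3 k₁ k₂ n
    (ArcDisjointColourings.k₁+[k₁+k₂]≤n+[n+1] {D = D} {E = complement D}
       (complement-disjoint {D = D}) uses-all₁ complete₁ complete₂)
    (ArcDisjointColourings.k₁+[k₁+k₂]≤n+[n+1] {D = complement D} {E = D}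
       (λ uv∈Dᶜ uv∈D → complement-disjoint {D = D} uv∈D uv∈Dᶜ)
       uses-all₂ complete₂ complete₁)
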